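{- The generating function $\sum_P z^{\mathrm{area}(P)}$, summed over all Stanley polyominoes $P$, equals \[ \frac{\displaystyle\sum_{\ell\ge 0}\frac{(-1)^{\ell}z^{\frac{(\ell+2)(\ell+1)}{2}}}{(z,z)_\ell^2\left(1-z^{\ell+1}\right)}}{\displaystyle 1-\sum_{\ell\geq 0}\frac{(-1)^{\ell}z^{\frac{(\ell+4)(\ell+1)}{2}}}{(z,z)_{\ell+1}^2}}. \]
   Context: Cells are unit squares $[i,i+1]\times[j,j+1]$ with $i,j\in\mathbb{Z}$. A Stanley polyomino (up to translation) is a set of cells forming $k\geq 1$ rows $0,\dots,k-1$ (bottom to top), row $j$ consisting of the cells with $s_j\le i\le e_j$ ($s_j\le e_j$ integers), such that $s_{j-1}<s_j\le e_{j-1}<e_j$ for $1\le j\le k-1$. $\mathrm{area}(P)$ is the number of cells. The Pochhammer symbol is $(a,b)_k=\prod_{j=0}^{k-1}(1-ab^j)$. -}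

module Defs where

open import Data.Nat using (ℕ; zero; suc; _≤_; _<_; _∸_; _≤?_)
open import Data.Nat.Divisibility using (_∣?_)
import Data.Nat as ℕ
open import Data.Nat.DivMod using (_/_)
open import Data.Integer using (ℤ; +_; -_; _+_; _*_)
open import Data.List using (List; []; _∷_)
open import Data.List.Relation.Unary.All using (All)
open import Data.List.Relation.Unary.Linked using (Linked)
open import Data.Product using (_×_; _,_; Σ)
open import Data.Empty using (⊥)
open import Relation.Binary.PropositionalEquality using (_≡_)
open import Relation.Nullary.Decidable using (does)
open import Data.Bool using (if_then_else_)

-- A row j is the pair (s_j , e_j): the cells [i,i+1]×[j,j+1], s_j ≤ i ≤ e_j.
-- A polyomino is the list of its rows from bottom (row 0) to top (row k-1).
-- Translation invariance is handled by choosing the canonical representative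
-- with s_0 = 0 (vertical position is already fixed by numbering rows 0..k-1).
-- Since the s_j are strictly increasing, all s_j, e_j are then ≥ 0, so ℕ
-- coordinates suffice.

Row : Set
Row = ℕ × ℕ

WellFormedRow : Row → Set
WellFormedRow (s , e) = s ≤ e

Adjacent : Row → Row → Set
Adjacent (s , e) (s' , e') = (s < s') × (s' ≤ e) × (e < e')

IsStanley : List Row → Set
IsStanley [] = ⊥
IsStanley ((s , e) ∷ rs) =
  (s ≡ 0) × All WellFormedRow ((s , e) ∷ rs) × Linked Adjacent ((s , e) ∷ rs)

area : List Row → ℕ
area [] = 0
area ((s , e) ∷ rs) = suc (e ∸ s) ℕ.+ area rs

StanleyOfArea : ℕ → Set
StanleyOfArea n = Σ (List Row) (λ rs → IsStanley rs × (area rs ≡ n))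

PS : Set
PS = ℕ → ℤ

sumTo : ℕ → (ℕ → ℤ) → ℤ
sumTo zero f = f 0
sumTo (suc n) f = sumTo n f + f (suc n)

one : PS
one zero = + 1
one (suc _) = + 0

_⊝_ : PS → PS → PS
(f ⊝ g) n = f n + - g n

_⊛_ : PS → PS → PS
(f ⊛ g) n = sumTo n (λ i → f i * g (n ∸ i))

scale : ℤ → PS → PS
scale c f n = c * f n

shift : ℕ → PS → PS
shift m f n = if does (m ≤? n) then f (n ∸ m) else + 0

-- 1 / (1 - z^(suc j)) = Σ_{m ≥ 0} z^{(j+1) m}
geom : ℕ → PS
geom j n = if does (suc j ∣? n) then + 1 else + 0

-- 1 / (z,z)_ℓ = Π_{j=0}^{ℓ-1} 1/(1 - z^{j+1})
invPoch : ℕ → PS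
invPoch zero = one
invPoch (suc ℓ) = invPoch ℓ ⊛ geom ℓ

sign : ℕ → ℤ
sign zero = + 1
sign (suc ℓ) = - sign ℓ

numTerm : ℕ → PS
numTerm ℓ = scale (sign ℓ)
  (shift (((ℓ ℕ.+ 2) ℕ.* (ℓ ℕ.+ 1)) / 2)
    ((invPoch ℓ ⊛ invPoch ℓ) ⊛ geom ℓ))

denTerm : ℕ → PS
denTerm ℓ = scale (sign ℓ)
  (shift (((ℓ ℕ.+ 4) ℕ.* (ℓ ℕ.+ 1)) / 2)
    (invPoch (suc ℓ) ⊛ invPoch (suc ℓ)))

-- Infinite sums Σ_{ℓ ≥ 0}: the ℓ-th summand is divisible by z^{ℓ+1}
-- (its exponent (ℓ+2)(ℓ+1)/2 resp. (ℓ+4)(ℓ+1)/2 is ≥ ℓ+1), so the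
-- coefficient of z^n only receives contributions from ℓ ≤ n.
Numerator : PS
Numerator n = sumTo n (λ ℓ → numTerm ℓ n)

DenSum : PS
DenSum n = sumTo n (λ ℓ → denTerm ℓ n)

Denominator : PS
Denominator = one ⊝ DenSum

ofCount : (ℕ → ℕ) → PS
ofCount G n = + G n

{-# OPTIONS --safe #-}
-- Let T_L count, by area, the ways to stack rows on a bottom row of length L, and let
-- A_c = Σ_{L>c} z^L T_L. The rows that fit on a row of length l + 1 are, for each i < l, the rows
-- of length L > i + 1 that start i cells before its end; hence T_{l+1} = 1 + A_1 + ⋯ + A_l.
-- Weighting the cells of the bottom row by z^(ℓ+1), i.e. putting Φ_ℓ = Σ_l z^((ℓ+1)(l+1)) T_{l+1}
-- and Ψ_ℓ = Σ_l z^((ℓ+1)(l+1)) A_{l+1}, this becomes the linear system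
--   Φ_ℓ = z^(ℓ+1) (1 + Φ_ℓ + Ψ_ℓ),   Φ_{ℓ+1} + Ψ_ℓ = z^(ℓ+1) (Φ_0 + Ψ_ℓ),
-- which expresses Φ_ℓ through Φ_0 and Φ_{ℓ+1} with coefficients in z and 1/(1 - z^(ℓ+1)).
-- After multiplying by (-1)^ℓ z^(ℓ(ℓ+1)/2) / (z,z)_ℓ^2 these relations telescope: Φ_0 equals
-- Σ_ℓ (numerator summand + denominator summand · Φ_0), the remainder after K steps being
-- O(z^(K(K+1)/2)). Finally, Φ_0 is the generating function of Stanley polyominoes.
module Submission where

open import Defs
open import Data.Nat using (ℕ)
open import Data.Fin using (Fin)
open import Data.Product using (Σ; _×_)
open import Function.Bundles using (_↔_)
open import Relation.Binary.PropositionalEquality using (_≡_)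

open import Data.Bool using (true; false; if_then_else_)
open import Data.Bool.Properties using (if-float)
open import Data.Empty using (⊥-elim)
import Data.Fin as Fin
open import Data.Fin.Properties using (+↔⊎)
open import Data.Integer using (ℤ; +_; -_; _+_; _*_)
import Data.Integer.Properties as ℤₚ
open import Algebra.Properties.CommutativeSemigroup ℤₚ.+-commutativeSemigroup using (interchange)
open import Data.Integer.Solver using (module +-*-Solver)
import Data.Nat as ℕ
open import Data.Nat using (zero; suc; _≤_; _<_; _∸_; _≤?_; z≤n; s≤s)
import Data.Nat.Properties as ℕₚ
open import Data.Nat.Divisibility using (_∣_; _∣?_; _∣0; >⇒∤; ∣m+n∣m⇒∣n; ∣m∸n∣n⇒∣m; ∣-refl)
open import Data.Nat.DivMod using (_/_; m*n/n≡m)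
open import Data.Nat.Induction using (<-rec)
import Data.Nat.Tactic.RingSolver as ℕ-Ring
open import Data.Product using (_,_; proj₂)
open import Data.Product.Function.Dependent.Propositional using (Σ-↔)
open import Data.Product.Function.NonDependent.Propositional using (_×-↔_)
open import Data.Sum using (_⊎_; inj₁; inj₂)
open import Data.Sum.Function.Propositional using (_⊎-↔_)
open import Data.Unit using (⊤; tt)
open import Data.List using (List; []; _∷_; [_])
open import Data.List.Relation.Unary.All using (All; []; _∷_)
open import Data.List.Relation.Unary.Linked using (Linked; [-]; _∷_)
open import Function using (_∘_)
open import Function.Bundles using (_⇔_; mk⇔; mk↔ₛ′)
open import Function.Properties.Inverse using (↔-refl; ↔-sym; ↔-trans)
open import Function.Related.TypeIsomorphisms using (∃-≡)
open import Relation.Binary.PropositionalEquality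
  using (_≗_; refl; sym; trans; cong; cong₂; subst; _→-setoid_; module ≡-Reasoning)
import Relation.Binary.Reasoning.Setoid as SetoidReasoning
open import Relation.Nullary using (¬_; Irrelevant; does; yes; no)
open import Relation.Nullary.Decidable using (dec-true; dec-false; does-⇔)

sumTo-cong : ∀ n {f g : ℕ → ℤ} → (∀ i → i ≤ n → f i ≡ g i) → sumTo n f ≡ sumTo n g
sumTo-cong zero    f≡g = f≡g 0 z≤n
sumTo-cong (suc n) f≡g =
  cong₂ _+_ (sumTo-cong n (λ i i≤n → f≡g i (ℕₚ.m≤n⇒m≤1+n i≤n))) (f≡g (suc n) ℕₚ.≤-refl)

sumTo-zero : ∀ n {f : ℕ → ℤ} → (∀ i → i ≤ n → f i ≡ + 0) → sumTo n f ≡ + 0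
sumTo-zero zero    f≡0 = f≡0 0 z≤n
sumTo-zero (suc n) f≡0 =
  cong₂ _+_ (sumTo-zero n (λ i i≤n → f≡0 i (ℕₚ.m≤n⇒m≤1+n i≤n))) (f≡0 (suc n) ℕₚ.≤-refl)

sumTo-+ : ∀ n (f g : ℕ → ℤ) → sumTo n (λ i → f i + g i) ≡ sumTo n f + sumTo n g
sumTo-+ zero    f g = refl
sumTo-+ (suc n) f g = trans (cong (_+ (f (suc n) + g (suc n))) (sumTo-+ n f g))
  (interchange (sumTo n f) (sumTo n g) (f (suc n)) (g (suc n)))

*-sumTo : ∀ n c (f : ℕ → ℤ) → c * sumTo n f ≡ sumTo n (λ i → c * f i)
*-sumTo zero    c f = refl
*-sumTo (suc n) c f =
  trans (ℤₚ.*-distribˡ-+ c (sumTo n f) (f (suc n))) (cong (_+ c * f (suc n)) (*-sumTo n c f))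

neg-sumTo : ∀ n (f : ℕ → ℤ) → - sumTo n f ≡ sumTo n (λ i → - f i)
neg-sumTo zero    f = refl
neg-sumTo (suc n) f =
  trans (ℤₚ.neg-distrib-+ (sumTo n f) (f (suc n))) (cong (_+ - f (suc n)) (neg-sumTo n f))

sumTo-suc : ∀ n (f : ℕ → ℤ) → sumTo (suc n) f ≡ f 0 + sumTo n (f ∘ suc)
sumTo-suc zero    f = refl
sumTo-suc (suc n) f =
  trans (cong (_+ f (suc (suc n))) (sumTo-suc n f)) (ℤₚ.+-assoc (f 0) _ _)

sumTo-reverse : ∀ n (f : ℕ → ℤ) → sumTo n f ≡ sumTo n (λ i → f (n ∸ i))
sumTo-reverse zero    f = refl
sumTo-reverse (suc n) f = begin
  sumTo n f + f (suc n)                       ≡⟨ cong (_+ f (suc n)) (sumTo-reverse n f) ⟩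
  sumTo n (λ i → f (n ∸ i)) + f (suc n)       ≡⟨ ℤₚ.+-comm _ (f (suc n)) ⟩
  f (suc n) + sumTo n (λ i → f (n ∸ i))       ≡⟨ sumTo-suc n (λ i → f (suc n ∸ i)) ⟨
  sumTo (suc n) (λ i → f (suc n ∸ i))         ∎
  where open ≡-Reasoning

sumTo-extend : ∀ {m n} (f : ℕ → ℤ) → m ≤ n → (∀ i → m < i → i ≤ n → f i ≡ + 0) →
               sumTo n f ≡ sumTo m f
sumTo-extend {n = zero}  f z≤n _ = refl
sumTo-extend {m} {suc n} f m≤n f≡0 with ℕₚ.m≤n⇒m<n∨m≡n m≤n
... | inj₂ refl       = refl
... | inj₁ (s≤s m≤n′) = begin
  sumTo n f + f (suc n)
    ≡⟨ cong₂ _+_ (sumTo-extend f m≤n′ λ i m<i i≤n → f≡0 i m<i (ℕₚ.m≤n⇒m≤1+n i≤n))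
                 (f≡0 (suc n) (s≤s m≤n′) ℕₚ.≤-refl) ⟩
  sumTo m f + + 0       ≡⟨ ℤₚ.+-identityʳ _ ⟩
  sumTo m f             ∎
  where open ≡-Reasoning

infixl 6 _⊕_

_⊕_ : PS → PS → PS
(f ⊕ g) n = f n + g n

neg : PS → PS
neg f n = - f n

𝟘 : PS
𝟘 _ = + 0

tail : PS → PS
tail f n = f (suc n)

module ≗-Reasoning = SetoidReasoning (ℕ →-setoid ℤ)

≗-sym : {f g : PS} → f ≗ g → g ≗ f
≗-sym f≗g n = sym (f≗g n)

≗-trans : {f g h : PS} → f ≗ g → g ≗ h → f ≗ h
≗-trans f≗g g≗h n = trans (f≗g n) (g≗h n)

⊕-cong : ∀ {f f′ g g′} → f ≗ f′ → g ≗ g′ → f ⊕ g ≗ f′ ⊕ g′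
⊕-cong f≗f′ g≗g′ n = cong₂ _+_ (f≗f′ n) (g≗g′ n)

⊕-congˡ : ∀ {f f′} g → f ≗ f′ → f ⊕ g ≗ f′ ⊕ g
⊕-congˡ g f≗f′ n = cong (_+ g n) (f≗f′ n)

⊕-congʳ : ∀ f {g g′} → g ≗ g′ → f ⊕ g ≗ f ⊕ g′
⊕-congʳ f g≗g′ n = cong (λ x → f n + x) (g≗g′ n)

⊕-assoc : ∀ f g h → (f ⊕ g) ⊕ h ≗ f ⊕ (g ⊕ h)
⊕-assoc f g h n = ℤₚ.+-assoc (f n) (g n) (h n)

⊕-comm : ∀ f g → f ⊕ g ≗ g ⊕ f
⊕-comm f g n = ℤₚ.+-comm (f n) (g n)

neg-scale : ∀ c f → neg (scale c f) ≗ scale (- c) f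
neg-scale c f n = ℤₚ.neg-distribˡ-* c (f n)

neg-cong : ∀ {f g} → f ≗ g → neg f ≗ neg g
neg-cong f≗g n = cong -_ (f≗g n)

scale-cong : ∀ c {f g} → f ≗ g → scale c f ≗ scale c g
scale-cong c f≗g n = cong (c *_) (f≗g n)

⊛-congˡ-upTo : ∀ {f f′} g n → (∀ i → i ≤ n → f i ≡ f′ i) → (f ⊛ g) n ≡ (f′ ⊛ g) n
⊛-congˡ-upTo g n f≡f′ = sumTo-cong n (λ i i≤n → cong (_* g (n ∸ i)) (f≡f′ i i≤n))

⊛-congˡ : ∀ {f f′} g → f ≗ f′ → f ⊛ g ≗ f′ ⊛ g
⊛-congˡ g f≗f′ n = ⊛-congˡ-upTo g n (λ i _ → f≗f′ i)

⊛-congʳ : ∀ f {g g′} → g ≗ g′ → f ⊛ g ≗ f ⊛ g′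
⊛-congʳ f g≗g′ n = sumTo-cong n (λ i _ → cong (f i *_) (g≗g′ (n ∸ i)))

⊛-suc : ∀ f g n → (f ⊛ g) (suc n) ≡ f 0 * g (suc n) + (tail f ⊛ g) n
⊛-suc f g n = sumTo-suc n (λ i → f i * g (suc n ∸ i))

⊛-comm : ∀ f g → f ⊛ g ≗ g ⊛ f
⊛-comm f g n = trans (sumTo-reverse n _) (sumTo-cong n λ i i≤n →
  trans (cong (λ k → f (n ∸ i) * g k) (ℕₚ.m∸[m∸n]≡n i≤n)) (ℤₚ.*-comm (f (n ∸ i)) (g i)))

⊛-zeroˡ : ∀ g → 𝟘 ⊛ g ≗ 𝟘
⊛-zeroˡ g n = sumTo-zero n (λ i _ → refl)

⊛-identityˡ : ∀ g → one ⊛ g ≗ g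
⊛-identityˡ g zero    = ℤₚ.*-identityˡ (g 0)
⊛-identityˡ g (suc n) = begin
  (one ⊛ g) (suc n)                  ≡⟨ ⊛-suc one g n ⟩
  + 1 * g (suc n) + (𝟘 ⊛ g) n        ≡⟨ cong₂ _+_ (ℤₚ.*-identityˡ (g (suc n))) (⊛-zeroˡ g n) ⟩
  g (suc n) + + 0                    ≡⟨ ℤₚ.+-identityʳ _ ⟩
  g (suc n)                          ∎
  where open ≡-Reasoning

⊛-identityʳ : ∀ f → f ⊛ one ≗ f
⊛-identityʳ f n = trans (⊛-comm f one n) (⊛-identityˡ f n)

⊛-distribʳ : ∀ f f′ g → (f ⊕ f′) ⊛ g ≗ f ⊛ g ⊕ f′ ⊛ g
⊛-distribʳ f f′ g n =
  trans (sumTo-cong n (λ i _ → ℤₚ.*-distribʳ-+ (g (n ∸ i)) (f i) (f′ i))) (sumTo-+ n _ _)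

⊛-distribˡ : ∀ f g g′ → f ⊛ (g ⊕ g′) ≗ f ⊛ g ⊕ f ⊛ g′
⊛-distribˡ f g g′ n = begin
  (f ⊛ (g ⊕ g′)) n            ≡⟨ ⊛-comm f (g ⊕ g′) n ⟩
  ((g ⊕ g′) ⊛ f) n            ≡⟨ ⊛-distribʳ g g′ f n ⟩
  (g ⊛ f) n + (g′ ⊛ f) n      ≡⟨ cong₂ _+_ (⊛-comm g f n) (⊛-comm g′ f n) ⟩
  (f ⊛ g) n + (f ⊛ g′) n      ∎
  where open ≡-Reasoning

⊛-scaleˡ : ∀ c f g → scale c f ⊛ g ≗ scale c (f ⊛ g)
⊛-scaleˡ c f g n =
  trans (sumTo-cong n (λ i _ → ℤₚ.*-assoc c (f i) (g (n ∸ i)))) (sym (*-sumTo n c _))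

⊛-negʳ : ∀ f g → f ⊛ neg g ≗ neg (f ⊛ g)
⊛-negʳ f g n =
  trans (sumTo-cong n (λ i _ → sym (ℤₚ.neg-distribʳ-* (f i) (g (n ∸ i))))) (sym (neg-sumTo n _))

⊛-assoc : ∀ f g h → (f ⊛ g) ⊛ h ≗ f ⊛ (g ⊛ h)
⊛-assoc f g h zero    = ℤₚ.*-assoc (f 0) (g 0) (h 0)
⊛-assoc f g h (suc n) = begin
  ((f ⊛ g) ⊛ h) (suc n)
    ≡⟨ ⊛-suc (f ⊛ g) h n ⟩
  f 0 * g 0 * h (suc n) + (tail (f ⊛ g) ⊛ h) n
    ≡⟨ cong (λ x → f 0 * g 0 * h (suc n) + x) (⊛-congˡ h (⊛-suc f g) n) ⟩
  f 0 * g 0 * h (suc n) + ((scale (f 0) (tail g) ⊕ tail f ⊛ g) ⊛ h) n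
    ≡⟨ cong (λ x → f 0 * g 0 * h (suc n) + x) (trans (⊛-distribʳ (scale (f 0) (tail g)) (tail f ⊛ g) h n)
         (cong₂ _+_ (⊛-scaleˡ (f 0) (tail g) h n) (⊛-assoc (tail f) g h n))) ⟩
  f 0 * g 0 * h (suc n) + (f 0 * (tail g ⊛ h) n + (tail f ⊛ (g ⊛ h)) n)
    ≡⟨ solve 5 (λ a b c d e → a :* b :* c :+ (a :* d :+ e) := a :* (b :* c :+ d) :+ e) refl
         (f 0) (g 0) (h (suc n)) ((tail g ⊛ h) n) ((tail f ⊛ (g ⊛ h)) n) ⟩
  f 0 * (g 0 * h (suc n) + (tail g ⊛ h) n) + (tail f ⊛ (g ⊛ h)) n
    ≡⟨ cong (λ x → f 0 * x + (tail f ⊛ (g ⊛ h)) n) (⊛-suc g h n) ⟨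
  f 0 * (g ⊛ h) (suc n) + (tail f ⊛ (g ⊛ h)) n
    ≡⟨ ⊛-suc f (g ⊛ h) n ⟨
  (f ⊛ (g ⊛ h)) (suc n) ∎
  where
  open ≡-Reasoning
  open +-*-Solver

⊛-interchange : ∀ a b c d → (a ⊛ b) ⊛ (c ⊛ d) ≗ (a ⊛ c) ⊛ (b ⊛ d)
⊛-interchange a b c d = begin
  (a ⊛ b) ⊛ (c ⊛ d)  ≈⟨ ⊛-assoc a b (c ⊛ d) ⟩
  a ⊛ (b ⊛ (c ⊛ d))  ≈⟨ ⊛-congʳ a (⊛-assoc b c d) ⟨
  a ⊛ ((b ⊛ c) ⊛ d)  ≈⟨ ⊛-congʳ a (⊛-congˡ d (⊛-comm b c)) ⟩
  a ⊛ ((c ⊛ b) ⊛ d)  ≈⟨ ⊛-congʳ a (⊛-assoc c b d) ⟩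
  a ⊛ (c ⊛ (b ⊛ d))  ≈⟨ ⊛-assoc a c (b ⊛ d) ⟨
  (a ⊛ c) ⊛ (b ⊛ d)  ∎
  where open ≗-Reasoning

shift-suc : ∀ a f n → shift (suc a) f (suc n) ≡ shift a f n
shift-suc zero    f n = refl
shift-suc (suc a) f n = refl

shift-below : ∀ a f {n} → n < a → shift a f n ≡ + 0
shift-below a f {n} n<a = cong (λ b → if b then f (n ∸ a) else + 0) (dec-false (a ≤? n) (ℕₚ.<⇒≱ n<a))

shift-above : ∀ a f {n} → a ≤ n → shift a f n ≡ f (n ∸ a)
shift-above a f {n} a≤n = cong (λ b → if b then f (n ∸ a) else + 0) (dec-true (a ≤? n) a≤n)

shift-cong : ∀ a {f g} → f ≗ g → shift a f ≗ shift a g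
shift-cong a f≗g n = cong (λ x → if does (a ≤? n) then x else + 0) (f≗g (n ∸ a))

shift-cong-at : ∀ a f g n → (a ≤ n → f (n ∸ a) ≡ g (n ∸ a)) → shift a f n ≡ shift a g n
shift-cong-at a f g n f≡g with a ≤? n
... | yes a≤n = trans (shift-above a f a≤n) (trans (f≡g a≤n) (sym (shift-above a g a≤n)))
... | no  a≰n = trans (shift-below a f (ℕₚ.≰⇒> a≰n)) (sym (shift-below a g (ℕₚ.≰⇒> a≰n)))

shift-≡ : ∀ {a b} f → a ≡ b → shift a f ≗ shift b f
shift-≡ f refl n = refl

shift-⊕ : ∀ a f g → shift a (f ⊕ g) ≗ shift a f ⊕ shift a g
shift-⊕ a f g n = distrib (does (a ≤? n))
  where
  distrib : ∀ b → (if b then f (n ∸ a) + g (n ∸ a) else + 0)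
                ≡ (if b then f (n ∸ a) else + 0) + (if b then g (n ∸ a) else + 0)
  distrib true  = refl
  distrib false = refl

shift-neg : ∀ a f → shift a (neg f) ≗ neg (shift a f)
shift-neg a f n = sym (if-float -_ (does (a ≤? n)))

shift-shift : ∀ a b f → shift a (shift b f) ≗ shift (a ℕ.+ b) f
shift-shift zero    b f n       = refl
shift-shift (suc a) b f zero    = refl
shift-shift (suc a) b f (suc n) = begin
  shift (suc a) (shift b f) (suc n) ≡⟨ shift-suc a (shift b f) n ⟩
  shift a (shift b f) n             ≡⟨ shift-shift a b f n ⟩
  shift (a ℕ.+ b) f n               ≡⟨ shift-suc (a ℕ.+ b) f n ⟨
  shift (suc a ℕ.+ b) f (suc n)     ∎
  where open ≡-Reasoning

shift-+ : ∀ a b f → shift (b ℕ.+ a) f ≗ shift a (shift b f)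
shift-+ a b f n = trans (shift-≡ f (ℕₚ.+-comm b a) n) (sym (shift-shift a b f n))

shift-⊛ : ∀ a f g → shift a f ⊛ g ≗ shift a (f ⊛ g)
shift-⊛ zero    f g n       = refl
shift-⊛ (suc a) f g zero    = ℤₚ.*-zeroˡ (g 0)
shift-⊛ (suc a) f g (suc n) = begin
  (shift (suc a) f ⊛ g) (suc n)                ≡⟨ ⊛-suc (shift (suc a) f) g n ⟩
  + 0 * g (suc n) + (tail (shift (suc a) f) ⊛ g) n
    ≡⟨ cong (λ x → + 0 * g (suc n) + x) (⊛-congˡ g (shift-suc a f) n) ⟩
  + 0 * g (suc n) + (shift a f ⊛ g) n          ≡⟨ cong (λ x → + 0 * g (suc n) + x) (shift-⊛ a f g n) ⟩
  + 0 * g (suc n) + shift a (f ⊛ g) n          ≡⟨ cong (_+ shift a (f ⊛ g) n) (ℤₚ.*-zeroˡ (g (suc n))) ⟩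
  + 0 + shift a (f ⊛ g) n                      ≡⟨ ℤₚ.+-identityˡ _ ⟩
  shift a (f ⊛ g) n                            ≡⟨ shift-suc a (f ⊛ g) n ⟨
  shift (suc a) (f ⊛ g) (suc n)                ∎
  where open ≡-Reasoning

⊛-shift : ∀ a f g → f ⊛ shift a g ≗ shift a (f ⊛ g)
⊛-shift a f g n = begin
  (f ⊛ shift a g) n     ≡⟨ ⊛-comm f (shift a g) n ⟩
  (shift a g ⊛ f) n     ≡⟨ shift-⊛ a g f n ⟩
  shift a (g ⊛ f) n     ≡⟨ shift-cong a (⊛-comm g f) n ⟩
  shift a (f ⊛ g) n     ∎
  where open ≡-Reasoning

∣⇔∣∸ : ∀ d {n} → d ≤ n → d ∣ n ⇔ d ∣ n ∸ d
∣⇔∣∸ d {n} d≤n = mk⇔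
  (λ d∣n → ∣m+n∣m⇒∣n (subst (d ∣_) (sym (ℕₚ.m+[n∸m]≡n d≤n)) d∣n) ∣-refl)
  (λ d∣n∸d → ∣m∸n∣n⇒∣m d d≤n d∣n∸d ∣-refl)

geom-unfold : ∀ ℓ → geom ℓ ≗ one ⊕ shift (suc ℓ) (geom ℓ)
geom-unfold ℓ zero    = cong (λ b → if b then + 1 else + 0) (dec-true (suc ℓ ∣? 0) (suc ℓ ∣0))
geom-unfold ℓ (suc n) with suc ℓ ≤? suc n
... | yes ℓ<n = begin
  geom ℓ (suc n)
    ≡⟨ cong (λ b → if b then + 1 else + 0)
            (does-⇔ (∣⇔∣∸ (suc ℓ) ℓ<n) (suc ℓ ∣? suc n) (suc ℓ ∣? (n ∸ ℓ))) ⟩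
  geom ℓ (n ∸ ℓ)                        ≡⟨ shift-above (suc ℓ) (geom ℓ) ℓ<n ⟨
  shift (suc ℓ) (geom ℓ) (suc n)        ≡⟨ ℤₚ.+-identityˡ _ ⟨
  + 0 + shift (suc ℓ) (geom ℓ) (suc n)  ∎
  where open ≡-Reasoning
... | no ℓ≮n = begin
  geom ℓ (suc n)
    ≡⟨ cong (λ b → if b then + 1 else + 0) (dec-false (suc ℓ ∣? suc n) (>⇒∤ (ℕₚ.≰⇒> ℓ≮n))) ⟩
  + 0                                   ≡⟨ shift-below (suc ℓ) (geom ℓ) (ℕₚ.≰⇒> ℓ≮n) ⟨
  shift (suc ℓ) (geom ℓ) (suc n)        ≡⟨ ℤₚ.+-identityˡ _ ⟨
  + 0 + shift (suc ℓ) (geom ℓ) (suc n)  ∎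
  where open ≡-Reasoning

geom-⊛-unfold : ∀ ℓ Y → geom ℓ ⊛ Y ≗ Y ⊕ shift (suc ℓ) (geom ℓ ⊛ Y)
geom-⊛-unfold ℓ Y = begin
  geom ℓ ⊛ Y                                  ≈⟨ ⊛-congˡ Y (geom-unfold ℓ) ⟩
  (one ⊕ shift (suc ℓ) (geom ℓ)) ⊛ Y          ≈⟨ ⊛-distribʳ one (shift (suc ℓ) (geom ℓ)) Y ⟩
  one ⊛ Y ⊕ shift (suc ℓ) (geom ℓ) ⊛ Y        ≈⟨ ⊕-cong (⊛-identityˡ Y) (shift-⊛ (suc ℓ) (geom ℓ) Y) ⟩
  Y ⊕ shift (suc ℓ) (geom ℓ ⊛ Y)              ∎
  where open ≗-Reasoning

-- The coefficient of z^n on the right only involves coefficients of X below n.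
shift-fixpoint-unique : ∀ a {X X′ Y} →
  X ≗ Y ⊕ shift (suc a) X → X′ ≗ Y ⊕ shift (suc a) X′ → X ≗ X′
shift-fixpoint-unique a {X} {X′} {Y} X≗ X′≗ = <-rec (λ n → X n ≡ X′ n) step
  where
  step : ∀ n → (∀ {m} → m < n → X m ≡ X′ m) → X n ≡ X′ n
  step n ih = begin
    X n                       ≡⟨ X≗ n ⟩
    Y n + shift (suc a) X n   ≡⟨ cong (λ x → Y n + x) (shift-cong-at (suc a) X X′ n λ a<n →
                                   ih (ℕₚ.∸-monoʳ-< ℕₚ.0<1+n a<n)) ⟩
    Y n + shift (suc a) X′ n  ≡⟨ X′≗ n ⟨
    X′ n                      ∎
    where open ≡-Reasoning

geom² : ℕ → PS
geom² ℓ = geom ℓ ⊛ geom ℓ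

invPoch² : ℕ → PS
invPoch² ℓ = invPoch ℓ ⊛ invPoch ℓ

geom-⊛-solves : ∀ ℓ X Y → X ≗ Y ⊕ shift (suc ℓ) X → X ≗ geom ℓ ⊛ Y
geom-⊛-solves ℓ X Y X≗ = shift-fixpoint-unique ℓ {X} {geom ℓ ⊛ Y} {Y} X≗ (geom-⊛-unfold ℓ Y)

Ord≥ : ℕ → PS → Set
Ord≥ v f = ∀ n → n < v → f n ≡ + 0

Summable : (ℕ → PS) → Set
Summable F = ∀ i → Ord≥ i (F i)

-- Only for summable F is this the sum of the family: F i contributes nothing to z^n once i > n.
Σ∞ : (ℕ → PS) → PS
Σ∞ F n = sumTo n (λ i → F i n)

Ord≥-shift : ∀ a {v} f → v ≤ a → Ord≥ v (shift a f)
Ord≥-shift a f v≤a n n<v = shift-below a f (ℕₚ.<-≤-trans n<v v≤a)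

Ord≥-scale : ∀ c {v f} → Ord≥ v f → Ord≥ v (scale c f)
Ord≥-scale c f≡0 n n<v = trans (cong (c *_) (f≡0 n n<v)) (ℤₚ.*-zeroʳ c)

Ord≥-⊛ : ∀ {v f} g → Ord≥ v f → Ord≥ v (f ⊛ g)
Ord≥-⊛ g f≡0 n n<v = sumTo-zero n λ i i≤n →
  trans (cong (_* g (n ∸ i)) (f≡0 i (ℕₚ.≤-<-trans i≤n n<v))) (ℤₚ.*-zeroˡ (g (n ∸ i)))

Σ∞-cong : ∀ {F G} → (∀ i → F i ≗ G i) → Σ∞ F ≗ Σ∞ G
Σ∞-cong F≗G n = sumTo-cong n (λ i _ → F≗G i n)

Σ∞-⊕ : ∀ F G → Σ∞ (λ i → F i ⊕ G i) ≗ Σ∞ F ⊕ Σ∞ G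
Σ∞-⊕ F G n = sumTo-+ n _ _

Σ∞-suc : ∀ {F} → Summable F → Σ∞ F ≗ F 0 ⊕ Σ∞ (F ∘ suc)
Σ∞-suc {F} F-ord zero = sym (trans (cong (λ x → F 0 0 + x) (F-ord 1 0 ℕₚ.0<1+n)) (ℤₚ.+-identityʳ _))
Σ∞-suc {F} F-ord (suc n) = begin
  sumTo (suc n) (λ i → F i (suc n))                     ≡⟨ sumTo-suc n (λ i → F i (suc n)) ⟩
  F 0 (suc n) + sumTo n (λ i → F (suc i) (suc n))       ≡⟨ cong (λ x → F 0 (suc n) + x) (ℤₚ.+-identityʳ _) ⟨
  F 0 (suc n) + (sumTo n (λ i → F (suc i) (suc n)) + + 0)
    ≡⟨ cong (λ x → F 0 (suc n) + (sumTo n (λ i → F (suc i) (suc n)) + x))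
            (F-ord (suc (suc n)) (suc n) ℕₚ.≤-refl) ⟨
  F 0 (suc n) + Σ∞ (F ∘ suc) (suc n)                    ∎
  where open ≡-Reasoning

shift-Σ∞ : ∀ a {F} → Summable F → shift a (Σ∞ F) ≗ Σ∞ (λ i → shift a (F i))
shift-Σ∞ a {F} F-ord n with a ≤? n
... | yes a≤n = begin
  shift a (Σ∞ F) n                     ≡⟨ shift-above a (Σ∞ F) a≤n ⟩
  sumTo (n ∸ a) (λ i → F i (n ∸ a))    ≡⟨ sumTo-extend (λ i → F i (n ∸ a)) (ℕₚ.m∸n≤m n a)
                                            (λ i n∸a<i _ → F-ord i (n ∸ a) n∸a<i) ⟨
  sumTo n (λ i → F i (n ∸ a))          ≡⟨ sumTo-cong n (λ i _ → shift-above a (F i) a≤n) ⟨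
  Σ∞ (λ i → shift a (F i)) n           ∎
  where open ≡-Reasoning
... | no a≰n = trans (shift-below a (Σ∞ F) (ℕₚ.≰⇒> a≰n))
                     (sym (sumTo-zero n (λ i _ → shift-below a (F i) (ℕₚ.≰⇒> a≰n))))

Σ< : ℕ → (ℕ → PS) → PS
Σ< zero    F = 𝟘
Σ< (suc l) F = Σ< l F ⊕ F l

Σ<-sumTo : ∀ N F n → Σ< (suc N) F n ≡ sumTo N (λ i → F i n)
Σ<-sumTo zero    F n = ℤₚ.+-identityˡ (F 0 n)
Σ<-sumTo (suc N) F n = cong (_+ F (suc N) n) (Σ<-sumTo N F n)

Σ<-cons : ∀ l F n → Σ< (suc l) F n ≡ F 0 n + Σ< l (F ∘ suc) n
Σ<-cons zero    F n = trans (ℤₚ.+-identityˡ (F 0 n)) (sym (ℤₚ.+-identityʳ (F 0 n)))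
Σ<-cons (suc l) F n =
  trans (cong (_+ F (suc l) n) (Σ<-cons l F n)) (ℤₚ.+-assoc (F 0 n) _ (F (suc l) n))

Σ<-Σ∞ : ∀ {F} → Summable F → ∀ {n} N → n ≤ N → Σ< (suc N) F n ≡ Σ∞ F n
Σ<-Σ∞ {F} F-ord {n} N n≤N = trans (Σ<-sumTo N F n)
  (sumTo-extend (λ i → F i n) n≤N (λ i n<i _ → F-ord i n n<i))

Σ<-⊛ : ∀ K F g → Σ< K F ⊛ g ≗ Σ< K (λ i → F i ⊛ g)
Σ<-⊛ zero    F g = ⊛-zeroˡ g
Σ<-⊛ (suc K) F g n =
  trans (⊛-distribʳ (Σ< K F) (F K) g n) (cong (_+ (F K ⊛ g) n) (Σ<-⊛ K F g n))

sum< : ℕ → (ℕ → ℕ) → ℕ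
sum< zero    g = 0
sum< (suc K) g = g 0 ℕ.+ sum< K (g ∘ suc)

shiftℕ : ℕ → (ℕ → ℕ) → ℕ → ℕ
shiftℕ a g n = if does (a ≤? n) then g (n ∸ a) else 0

δ₀ : ℕ → ℕ
δ₀ zero    = 1
δ₀ (suc _) = 0

shiftℕ-below : ∀ a g {n} → n < a → shiftℕ a g n ≡ 0
shiftℕ-below a g {n} n<a = cong (λ b → if b then g (n ∸ a) else 0) (dec-false (a ≤? n) (ℕₚ.<⇒≱ n<a))

shiftℕ-above : ∀ a g {n} → a ≤ n → shiftℕ a g n ≡ g (n ∸ a)
shiftℕ-above a g {n} a≤n = cong (λ b → if b then g (n ∸ a) else 0) (dec-true (a ≤? n) a≤n)

Fin0↔ : {A : Set} → ¬ A → Fin 0 ↔ A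
Fin0↔ ¬a = mk↔ₛ′ (λ ()) (λ a → ⊥-elim (¬a a)) (λ a → ⊥-elim (¬a a)) (λ ())

Fin-δ₀ : ∀ n → Fin (δ₀ n) ↔ (n ≡ 0)
Fin-δ₀ zero    =
  mk↔ₛ′ (λ _ → refl) (λ _ → Fin.zero) (λ { refl → refl }) (λ { Fin.zero → refl ; (Fin.suc ()) })
Fin-δ₀ (suc n) = Fin0↔ (λ ())

Fin-+ : ∀ {a b} {A B : Set} → Fin a ↔ A → Fin b ↔ B → Fin (a ℕ.+ b) ↔ (A ⊎ B)
Fin-+ Fin↔A Fin↔B = ↔-trans +↔⊎ (Fin↔A ⊎-↔ Fin↔B)

Σℕ↔⊎ : (P : ℕ → Set) → Σ ℕ P ↔ (P 0 ⊎ Σ ℕ (P ∘ suc))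
Σℕ↔⊎ P = mk↔ₛ′
  (λ { (zero , p) → inj₁ p ; (suc i , p) → inj₂ (i , p) })
  (λ { (inj₁ p) → 0 , p ; (inj₂ (i , p)) → suc i , p })
  (λ { (inj₁ p) → refl ; (inj₂ (i , p)) → refl })
  (λ { (zero , p) → refl ; (suc i , p) → refl })

Fin-sum< : ∀ K {P : ℕ → Set} (g : ℕ → ℕ) →
           (∀ i → i < K → Fin (g i) ↔ P i) → (∀ i → K ≤ i → ¬ P i) → Fin (sum< K g) ↔ Σ ℕ P
Fin-sum< zero        g _     absent = Fin0↔ (λ (i , p) → absent i z≤n p)
Fin-sum< (suc K) {P} g count absent = ↔-trans
  (Fin-+ (count 0 ℕₚ.0<1+n)
         (Fin-sum< K (g ∘ suc) (λ i i<K → count (suc i) (s≤s i<K)) (λ i K≤i → absent (suc i) (s≤s K≤i))))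
  (↔-sym (Σℕ↔⊎ P))

Prop↔ : {A B : Set} → Irrelevant A → Irrelevant B → (A → B) → (B → A) → A ↔ B
Prop↔ A-irr B-irr to from = mk↔ₛ′ to from (λ _ → B-irr _ _) (λ _ → A-irr _ _)

×-inhabited-prop : {P B : Set} → P → Irrelevant P → (P × B) ↔ B
×-inhabited-prop p P-irr = mk↔ₛ′ proj₂ (p ,_) (λ _ → refl) (λ (p′ , b) → cong (_, b) (P-irr p p′))

Σ-fiber : ∀ a {n} (T : ℕ → Set) → a ≤ n → Σ ℕ (λ m → (a ℕ.+ m ≡ n) × T m) ↔ T (n ∸ a)
Σ-fiber a {n} T a≤n =
  ↔-trans (Σ-↔ ↔-refl (Prop↔ ℕₚ.≡-irrelevant ℕₚ.≡-irrelevant to from ×-↔ ↔-refl)) (↔-sym (∃-≡ T))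
  where
  to : ∀ {m} → a ℕ.+ m ≡ n → m ≡ n ∸ a
  to {m} eq = trans (sym (ℕₚ.m+n∸m≡n a m)) (cong (_∸ a) eq)
  from : ∀ {m} → m ≡ n ∸ a → a ℕ.+ m ≡ n
  from eq = trans (cong (a ℕ.+_) eq) (ℕₚ.m+[n∸m]≡n a≤n)

Fin-shiftℕ : ∀ a (c : ℕ → ℕ) n (T : ℕ → Set) → (a ≤ n → Fin (c (n ∸ a)) ↔ T (n ∸ a)) →
             Fin (shiftℕ a c n) ↔ Σ ℕ (λ m → (a ℕ.+ m ≡ n) × T m)
Fin-shiftℕ a c n T count with a ≤? n
... | yes a≤n = subst (λ k → Fin k ↔ _) (sym (shiftℕ-above a c a≤n))
                      (↔-trans (count a≤n) (↔-sym (Σ-fiber a T a≤n)))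
... | no  a≰n = subst (λ k → Fin k ↔ _) (sym (shiftℕ-below a c (ℕₚ.≰⇒> a≰n)))
                      (Fin0↔ (λ (m , a+m≡n , _) → a≰n (subst (a ≤_) a+m≡n (ℕₚ.m≤m+n a m))))

Σ-reindex : {P Q : ℕ → Set} (T : ℕ → Set) (f g : ℕ → ℕ) →
            (∀ {x} → P x → Q (f x)) → (∀ {y} → Q y → P (g y)) →
            (∀ {x} → P x → g (f x) ≡ x) → (∀ {y} → Q y → f (g y) ≡ y) →
            (∀ {x} → Irrelevant (P x)) → (∀ {y} → Irrelevant (Q y)) →
            Σ ℕ (λ y → Q y × T (g y)) ↔ Σ ℕ (λ x → P x × T x)
Σ-reindex {P} {Q} T f g P⇒Q Q⇒P gf≡ fg≡ P-irr Q-irr = mk↔ₛ′ to from to∘from from∘to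
  where
  to : Σ ℕ (λ y → Q y × T (g y)) → Σ ℕ (λ x → P x × T x)
  to (y , q , t) = g y , Q⇒P q , t
  from : Σ ℕ (λ x → P x × T x) → Σ ℕ (λ y → Q y × T (g y))
  from (x , p , t) = f x , P⇒Q p , subst T (sym (gf≡ p)) t
  to∘from : ∀ u → to (from u) ≡ u
  to∘from (x , p , t) = lemma (gf≡ p) _
    where
    lemma : ∀ {x′} (eq : x′ ≡ x) (p′ : P x′) → (x′ , p′ , subst T (sym eq) t) ≡ (x , p , t)
    lemma refl p′ = cong (λ p″ → x , p″ , t) (P-irr p′ p)
  from∘to : ∀ u → from (to u) ≡ u
  from∘to (y , q , t) = lemma (fg≡ q) (sym (gf≡ (Q⇒P q))) _
    where
    lemma : ∀ {y′} (eq : y′ ≡ y) (eq′ : g y ≡ g y′) (q′ : Q y′) →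
            (y′ , q′ , subst T eq′ t) ≡ (y , q , t)
    lemma refl eq′ q′ =
      cong₂ (λ q″ t″ → y , q″ , t″) (Q-irr q′ q) (cong (λ e → subst T e t) (ℕₚ.≡-irrelevant eq′ refl))

-- Stacking rows on a row of a Stanley polyomino

Stackings : ℕ → ℕ → ℕ → Set
Stackings s e n =
  Σ (List Row) λ rs → All WellFormedRow rs × Linked Adjacent ((s , e) ∷ rs) × area rs ≡ n

StackingsFrom : ℕ → ℕ → ℕ → Set
StackingsFrom s e n = Σ ℕ λ m → (suc (e ∸ s) ℕ.+ m ≡ n) × Stackings s e m

Stackings↔ : ∀ s e n → Stackings s e n ↔
  ((n ≡ 0) ⊎ Σ ℕ λ s′ → Σ ℕ λ e′ →
     Adjacent (s , e) (s′ , e′) × s′ ≤ e′ × StackingsFrom s′ e′ n)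
Stackings↔ s e n = mk↔ₛ′ to from to∘from from∘to
  where
  Unfolded : Set
  Unfolded = (n ≡ 0) ⊎ Σ ℕ λ s′ → Σ ℕ λ e′ →
    Adjacent (s , e) (s′ , e′) × s′ ≤ e′ × StackingsFrom s′ e′ n
  to : Stackings s e n → Unfolded
  to ([] , [] , [-] , refl) = inj₁ refl
  to ((s′ , e′) ∷ rs , s′≤e′ ∷ wf , adj ∷ linked , eq) =
    inj₂ (s′ , e′ , adj , s′≤e′ , area rs , eq , rs , wf , linked , refl)
  from : Unfolded → Stackings s e n
  from (inj₁ n≡0) = [] , [] , [-] , sym n≡0
  from (inj₂ (s′ , e′ , adj , s′≤e′ , _ , eq , rs , wf , linked , refl)) =
    (s′ , e′) ∷ rs , s′≤e′ ∷ wf , adj ∷ linked , eq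
  to∘from : ∀ x → to (from x) ≡ x
  to∘from (inj₁ refl) = refl
  to∘from (inj₂ (s′ , e′ , adj , s′≤e′ , _ , eq , rs , wf , linked , refl)) = refl
  from∘to : ∀ x → from (to x) ≡ x
  from∘to ([] , [] , [-] , refl) = refl
  from∘to ((s′ , e′) ∷ rs , s′≤e′ ∷ wf , adj ∷ linked , eq) = refl

<∸⇒<∸ : ∀ {e i s} → s ≤ e → i < e ∸ s → s < e ∸ i
<∸⇒<∸ {e} {i} {s} s≤e i<e∸s = ℕₚ.m+n≤o⇒m≤o∸n (suc s)
  (subst (_≤ e) (cong suc (ℕₚ.+-comm i s)) (ℕₚ.m≤o∸n⇒m+n≤o (suc i) s≤e i<e∸s))

-- A row (s′ , e′) fits on (s , e) iff s′ = e ∸ i and e′ = e + 1 + j with i < e ∸ s.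
nextRow↔ : ∀ {s e} (B : ℕ → ℕ → Set) → s ≤ e →
  Σ ℕ (λ i → (i < e ∸ s) × Σ ℕ (λ j → ⊤ × B (e ∸ i) (suc (e ℕ.+ j))))
  ↔ Σ ℕ (λ s′ → Σ ℕ λ e′ → Adjacent (s , e) (s′ , e′) × s′ ≤ e′ × B s′ e′)
nextRow↔ {s} {e} B s≤e = ↔-trans (↔-trans startAt (Σ-↔ ↔-refl (↔-refl ×-↔ endAt _))) regroup
  where
  startAt : Σ ℕ (λ i → (i < e ∸ s) × Σ ℕ (λ j → ⊤ × B (e ∸ i) (suc (e ℕ.+ j))))
          ↔ Σ ℕ (λ s′ → ((s < s′) × (s′ ≤ e)) × Σ ℕ (λ j → ⊤ × B s′ (suc (e ℕ.+ j))))
  startAt = Σ-reindex _ (e ∸_) (e ∸_)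
    (λ (s<s′ , s′≤e) → ℕₚ.∸-monoʳ-< s<s′ s′≤e)
    (λ {i} i<e∸s → <∸⇒<∸ s≤e i<e∸s , ℕₚ.m∸n≤m e i)
    (λ (_ , s′≤e) → ℕₚ.m∸[m∸n]≡n s′≤e)
    (λ i<e∸s → ℕₚ.m∸[m∸n]≡n (ℕₚ.≤-trans (ℕₚ.<⇒≤ i<e∸s) (ℕₚ.m∸n≤m e s)))
    (λ (p , q) (p′ , q′) → cong₂ _,_ (ℕₚ.<-irrelevant p p′) (ℕₚ.≤-irrelevant q q′))
    ℕₚ.<-irrelevant
  endAt : ∀ s′ → Σ ℕ (λ j → ⊤ × B s′ (suc (e ℕ.+ j))) ↔ Σ ℕ (λ e′ → (e < e′) × B s′ e′)
  endAt s′ = Σ-reindex (B s′) (λ e′ → e′ ∸ suc e) (λ j → suc (e ℕ.+ j))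
    (λ _ → tt) (λ {j} _ → s≤s (ℕₚ.m≤m+n e j))
    ℕₚ.m+[n∸m]≡n (λ {j} _ → ℕₚ.m+n∸m≡n e j)
    ℕₚ.<-irrelevant (λ _ _ → refl)
  regroup : Σ ℕ (λ s′ → ((s < s′) × (s′ ≤ e)) × Σ ℕ (λ e′ → (e < e′) × B s′ e′))
          ↔ Σ ℕ (λ s′ → Σ ℕ λ e′ → Adjacent (s , e) (s′ , e′) × s′ ≤ e′ × B s′ e′)
  regroup = mk↔ₛ′
    (λ (s′ , (s<s′ , s′≤e) , e′ , e<e′ , b) →
       s′ , e′ , (s<s′ , s′≤e , e<e′) , ℕₚ.≤-trans s′≤e (ℕₚ.<⇒≤ e<e′) , b)
    (λ (s′ , e′ , (s<s′ , s′≤e , e<e′) , _ , b) → s′ , (s<s′ , s′≤e) , e′ , e<e′ , b)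
    (λ (s′ , e′ , adj , s′≤e′ , b) → cong (λ p → s′ , e′ , adj , p , b) (ℕₚ.≤-irrelevant _ _))
    (λ _ → refl)

1+[m+o]∸[m∸n]≡1+[n+o] : ∀ {m n} o → n ≤ m → suc (m ℕ.+ o) ∸ (m ∸ n) ≡ suc (n ℕ.+ o)
1+[m+o]∸[m∸n]≡1+[n+o] {m} {n} o n≤m = begin
  suc (m ℕ.+ o) ∸ (m ∸ n)                ≡⟨ cong (λ k → suc (k ℕ.+ o) ∸ (m ∸ n)) (ℕₚ.m∸n+n≡m n≤m) ⟨
  suc (m ∸ n ℕ.+ n ℕ.+ o) ∸ (m ∸ n)      ≡⟨ cong (λ k → suc k ∸ (m ∸ n)) (ℕₚ.+-assoc (m ∸ n) n o) ⟩
  suc (m ∸ n ℕ.+ (n ℕ.+ o)) ∸ (m ∸ n)    ≡⟨ cong (_∸ (m ∸ n)) (ℕₚ.+-suc (m ∸ n) (n ℕ.+ o)) ⟨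
  (m ∸ n) ℕ.+ suc (n ℕ.+ o) ∸ (m ∸ n)    ≡⟨ ℕₚ.m+n∸m≡n (m ∸ n) (suc (n ℕ.+ o)) ⟩
  suc (n ℕ.+ o)                          ∎
  where open ≡-Reasoning

-- tailsWithin k L n is the number of stackings of area n on a row of length L once n < k.
-- By nextRow↔ the next row has length i + j + 2 with i < L - 1.
tailsWithin : ℕ → ℕ → ℕ → ℕ
tailsWithin zero    _       _ = 0
tailsWithin (suc k) zero    _ = 0
tailsWithin (suc k) (suc l) n = δ₀ n ℕ.+ sum< l λ i → sum< (suc n) λ j →
  shiftℕ (2 ℕ.+ (i ℕ.+ j)) (tailsWithin k (2 ℕ.+ (i ℕ.+ j))) n

tails : ℕ → ℕ → ℕ
tails L n = tailsWithin (suc n) L n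

nextRow-width : ∀ {s e i} j → i < e ∸ s → suc (e ℕ.+ j) ∸ (e ∸ i) ≡ suc (i ℕ.+ j)
nextRow-width {s} {e} j i<e∸s = 1+[m+o]∸[m∸n]≡1+[n+o] j (ℕₚ.≤-trans (ℕₚ.<⇒≤ i<e∸s) (ℕₚ.m∸n≤m e s))

Fin-tailsWithin : ∀ k {s e n} → n < k → s ≤ e → Fin (tailsWithin k (suc (e ∸ s)) n) ↔ Stackings s e n
Fin-tailsWithin (suc k) {s} {e} {n} (s≤s n≤k) s≤e = ↔-trans
  (Fin-+ (Fin-δ₀ n) (↔-trans (Fin-sum< (e ∸ s) _ countStart noStart) (nextRow↔ Rest s≤e)))
  (↔-sym (Stackings↔ s e n))
  where
  Rest : ℕ → ℕ → Set
  Rest s′ e′ = StackingsFrom s′ e′ n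
  countEnd : ∀ i → i < e ∸ s → ∀ j → j < suc n →
    Fin (shiftℕ (2 ℕ.+ (i ℕ.+ j)) (tailsWithin k (2 ℕ.+ (i ℕ.+ j))) n) ↔ (⊤ × Rest (e ∸ i) (suc (e ℕ.+ j)))
  countEnd i i<e∸s j _ = ↔-trans
    (subst (λ L → Fin (shiftℕ (suc L) (tailsWithin k (suc L)) n) ↔ Rest (e ∸ i) (suc (e ℕ.+ j)))
           (nextRow-width {s} j i<e∸s)
           (Fin-shiftℕ _ (tailsWithin k (suc (suc (e ℕ.+ j) ∸ (e ∸ i)))) n (Stackings (e ∸ i) (suc (e ℕ.+ j)))
              λ a≤n → Fin-tailsWithin k (ℕₚ.<-≤-trans (ℕₚ.∸-monoʳ-< ℕₚ.0<1+n a≤n) n≤k)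
                                        (ℕₚ.≤-trans (ℕₚ.m∸n≤m e i) (ℕₚ.m≤n⇒m≤1+n (ℕₚ.m≤m+n e j)))))
    (↔-sym (×-inhabited-prop tt (λ _ _ → refl)))
  noEnd : ∀ i → i < e ∸ s → ∀ j → suc n ≤ j → ¬ (⊤ × Rest (e ∸ i) (suc (e ℕ.+ j)))
  noEnd i i<e∸s j n<j (_ , m , eq , _) = ℕₚ.<⇒≱ n<j (begin
    j                                       ≤⟨ ℕₚ.m≤n+m j (suc i) ⟩
    suc i ℕ.+ j                             ≡⟨ nextRow-width {s} j i<e∸s ⟨
    suc (e ℕ.+ j) ∸ (e ∸ i)                 ≤⟨ ℕₚ.n≤1+n _ ⟩
    suc (suc (e ℕ.+ j) ∸ (e ∸ i))           ≤⟨ ℕₚ.m≤m+n _ m ⟩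
    suc (suc (e ℕ.+ j) ∸ (e ∸ i)) ℕ.+ m     ≡⟨ eq ⟩
    n                                       ∎)
    where open ℕₚ.≤-Reasoning
  countStart : ∀ i → i < e ∸ s →
    Fin (sum< (suc n) λ j → shiftℕ (2 ℕ.+ (i ℕ.+ j)) (tailsWithin k (2 ℕ.+ (i ℕ.+ j))) n)
    ↔ ((i < e ∸ s) × Σ ℕ (λ j → ⊤ × Rest (e ∸ i) (suc (e ℕ.+ j))))
  countStart i i<e∸s = ↔-trans (Fin-sum< (suc n) _ (countEnd i i<e∸s) (noEnd i i<e∸s))
                               (↔-sym (×-inhabited-prop i<e∸s ℕₚ.<-irrelevant))
  noStart : ∀ i → e ∸ s ≤ i → ¬ ((i < e ∸ s) × Σ ℕ (λ j → ⊤ × Rest (e ∸ i) (suc (e ℕ.+ j))))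
  noStart i e∸s≤i (i<e∸s , _) = ℕₚ.<⇒≱ i<e∸s e∸s≤i

StanleyOfArea↔ : ∀ n → StanleyOfArea n ↔ Σ ℕ (λ e → StackingsFrom 0 e n)
StanleyOfArea↔ n = mk↔ₛ′ to from to∘from from∘to
  where
  to : StanleyOfArea n → Σ ℕ (λ e → StackingsFrom 0 e n)
  to ((.0 , e) ∷ rs , (refl , _ ∷ wf , linked) , eq) = e , area rs , eq , rs , wf , linked , refl
  from : Σ ℕ (λ e → StackingsFrom 0 e n) → StanleyOfArea n
  from (e , _ , eq , rs , wf , linked , refl) = (0 , e) ∷ rs , (refl , z≤n ∷ wf , linked) , eq
  to∘from : ∀ x → to (from x) ≡ x
  to∘from (e , _ , eq , rs , wf , linked , refl) = refl
  from∘to : ∀ x → from (to x) ≡ x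
  from∘to ((.0 , e) ∷ rs , (refl , z≤n ∷ wf , linked) , eq) = refl

-- Stanley polyominoes of area n, counted by the length e + 1 of the bottom row.
polyominoes : ℕ → ℕ
polyominoes n = sum< (suc n) λ e → shiftℕ (suc e) (tails (suc e)) n

Fin-polyominoes : ∀ n → Fin (polyominoes n) ↔ StanleyOfArea n
Fin-polyominoes n = ↔-trans (Fin-sum< (suc n) _ count none) (↔-sym (StanleyOfArea↔ n))
  where
  count : ∀ e → e < suc n → Fin (shiftℕ (suc e) (tails (suc e)) n) ↔ StackingsFrom 0 e n
  count e _ = Fin-shiftℕ (suc e) (tails (suc e)) n (Stackings 0 e)
    (λ _ → Fin-tailsWithin (suc (n ∸ suc e)) ℕₚ.≤-refl z≤n)
  none : ∀ e → suc n ≤ e → ¬ StackingsFrom 0 e n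
  none e n<e (m , eq , _) = ℕₚ.<⇒≱ n<e (subst (e ≤_) eq (ℕₚ.≤-trans (ℕₚ.n≤1+n e) (ℕₚ.m≤m+n (suc e) m)))

sum<-cong : ∀ K {g g′ : ℕ → ℕ} → (∀ i → g i ≡ g′ i) → sum< K g ≡ sum< K g′
sum<-cong zero    g≡g′ = refl
sum<-cong (suc K) g≡g′ = cong₂ ℕ._+_ (g≡g′ 0) (sum<-cong K (g≡g′ ∘ suc))

shiftℕ-cong-at : ∀ a g g′ n → (a ≤ n → g (n ∸ a) ≡ g′ (n ∸ a)) → shiftℕ a g n ≡ shiftℕ a g′ n
shiftℕ-cong-at a g g′ n g≡g′ with a ≤? n
... | yes a≤n = trans (shiftℕ-above a g a≤n) (trans (g≡g′ a≤n) (sym (shiftℕ-above a g′ a≤n)))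
... | no  a≰n = trans (shiftℕ-below a g (ℕₚ.≰⇒> a≰n)) (sym (shiftℕ-below a g′ (ℕₚ.≰⇒> a≰n)))

tailsWithin-stable : ∀ {k k′} L {n} → n < k → n < k′ → tailsWithin k L n ≡ tailsWithin k′ L n
tailsWithin-stable {suc k} {suc k′} zero    _ _ = refl
tailsWithin-stable {suc k} {suc k′} (suc l) {n} (s≤s n≤k) (s≤s n≤k′) =
  cong (δ₀ n ℕ.+_) (sum<-cong l λ i → sum<-cong (suc n) λ j → next (suc (i ℕ.+ j)))
  where
  next : ∀ L → shiftℕ (suc L) (tailsWithin k (suc L)) n ≡ shiftℕ (suc L) (tailsWithin k′ (suc L)) n
  next L = shiftℕ-cong-at (suc L) (tailsWithin k (suc L)) (tailsWithin k′ (suc L)) n λ a≤n →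
    let n∸a<n = ℕₚ.∸-monoʳ-< ℕₚ.0<1+n a≤n in
    tailsWithin-stable (suc L) (ℕₚ.<-≤-trans n∸a<n n≤k) (ℕₚ.<-≤-trans n∸a<n n≤k′)

tails-unfold : ∀ l n → tails (suc l) n ≡ δ₀ n ℕ.+ sum< l λ i → sum< (suc n) λ j →
  shiftℕ (2 ℕ.+ (i ℕ.+ j)) (tails (2 ℕ.+ (i ℕ.+ j))) n
tails-unfold l n =
  cong (δ₀ n ℕ.+_) (sum<-cong l λ i → sum<-cong (suc n) λ j → next (suc (i ℕ.+ j)))
  where
  next : ∀ L → shiftℕ (suc L) (tailsWithin n (suc L)) n ≡ shiftℕ (suc L) (tails (suc L)) n
  next L = shiftℕ-cong-at (suc L) (tailsWithin n (suc L)) (tails (suc L)) n λ a≤n →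
    tailsWithin-stable (suc L) (ℕₚ.∸-monoʳ-< ℕₚ.0<1+n a≤n) ℕₚ.≤-refl

+-δ₀ : ∀ n → + δ₀ n ≡ one n
+-δ₀ zero    = refl
+-δ₀ (suc n) = refl

+-sum< : ∀ l g F n → (∀ i → + g i ≡ F i n) → + sum< l g ≡ Σ< l F n
+-sum< zero    g F n g≡F = refl
+-sum< (suc l) g F n g≡F = begin
  + (g 0 ℕ.+ sum< l (g ∘ suc))          ≡⟨ cong₂ _+_ (g≡F 0) (+-sum< l (g ∘ suc) (F ∘ suc) n (g≡F ∘ suc)) ⟩
  F 0 n + Σ< l (F ∘ suc) n              ≡⟨ Σ<-cons l F n ⟨
  Σ< (suc l) F n                        ∎
  where open ≡-Reasoning

+-sum<-suc : ∀ n g → + sum< (suc n) g ≡ sumTo n (λ j → + g j)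
+-sum<-suc n g = trans (+-sum< (suc n) g (λ j _ → + g j) n (λ _ → refl)) (Σ<-sumTo n _ n)

+-shiftℕ : ∀ a g n → + shiftℕ a g n ≡ shift a (ofCount g) n
+-shiftℕ a g n = if-float +_ (does (a ≤? n))

Tails : ℕ → PS
Tails L = ofCount (tails L)

Above : ℕ → PS
Above c = Σ∞ λ j → shift (suc c ℕ.+ j) (Tails (suc c ℕ.+ j))

Tails-unfold : ∀ l → Tails (suc l) ≗ one ⊕ Σ< l (Above ∘ suc)
Tails-unfold l n = trans (cong +_ (tails-unfold l n)) (cong₂ _+_ (+-δ₀ n)
  (+-sum< l _ (Above ∘ suc) n λ i → trans (+-sum<-suc n _) (sumTo-cong n λ j _ →
    +-shiftℕ (2 ℕ.+ (i ℕ.+ j)) (tails (2 ℕ.+ (i ℕ.+ j))) n)))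

-- Functional equations

Φ : ℕ → PS
Φ ℓ = Σ∞ λ l → shift (suc ℓ ℕ.* suc l) (Tails (suc l))

Ψ : ℕ → PS
Ψ ℓ = Σ∞ λ l → shift (suc ℓ ℕ.* suc l) (Above (suc l))

shift-*-summable : ∀ ℓ (X : ℕ → PS) → Summable (λ l → shift (suc ℓ ℕ.* l) (X l))
shift-*-summable ℓ X l = Ord≥-shift (suc ℓ ℕ.* l) (X l) (ℕₚ.m≤n*m l (suc ℓ))

shift-*-suc : ∀ m l f → shift (m ℕ.* suc l) f ≗ shift m (shift (m ℕ.* l) f)
shift-*-suc m l f n = trans (shift-≡ f (ℕₚ.*-suc m l) n) (sym (shift-shift m (m ℕ.* l) f n))

shift-*-zero : ∀ m f → shift (m ℕ.* 0) f ≗ f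
shift-*-zero m f = shift-≡ f (ℕₚ.*-zeroʳ m)

polyominoes-gf : ofCount polyominoes ≗ Φ 0
polyominoes-gf n = trans (+-sum<-suc n _) (sumTo-cong n λ e _ →
  trans (+-shiftℕ (suc e) (tails (suc e)) n) (shift-≡ (Tails (suc e)) (sym (ℕₚ.+-identityʳ (suc e))) n))

Above-suc : ∀ c → Above c ≗ shift (suc c) (Tails (suc c)) ⊕ Above (suc c)
Above-suc c = begin
  Above c                                        ≈⟨ Σ∞-suc summable ⟩
  F 0 ⊕ Σ∞ (F ∘ suc)                             ≈⟨ ⊕-cong (λ n → cong (term n) (ℕₚ.+-identityʳ c))
                                                           (Σ∞-cong λ j n → cong (term n) (ℕₚ.+-suc c j)) ⟩
  shift (suc c) (Tails (suc c)) ⊕ Above (suc c)  ∎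
  where
  open ≗-Reasoning
  term : ℕ → ℕ → ℤ
  term n k = shift (suc k) (Tails (suc k)) n
  F : ℕ → PS
  F j = shift (suc c ℕ.+ j) (Tails (suc c ℕ.+ j))
  summable : Summable F
  summable j = Ord≥-shift (suc c ℕ.+ j) (Tails (suc c ℕ.+ j)) (ℕₚ.m≤n⇒m≤1+n (ℕₚ.m≤n+m j c))

Φ-equation : ∀ ℓ → Φ ℓ ≗ shift (suc ℓ) (one ⊕ (Φ ℓ ⊕ Ψ ℓ))
Φ-equation ℓ = begin
  Φ ℓ                                     ≈⟨ Σ∞-cong (λ l → ≗-trans (shift-cong (m ℕ.* suc l) (Tails-unfold l))
                                                                   (shift-*-suc m l (B l))) ⟩
  Σ∞ (λ l → shift m (X l))                ≈⟨ shift-Σ∞ m (shift-*-summable ℓ B) ⟨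
  shift m (Σ∞ X)                          ≈⟨ shift-cong m (Σ∞-suc (shift-*-summable ℓ B)) ⟩
  shift m (X 0 ⊕ Σ∞ (X ∘ suc))            ≈⟨ shift-cong m (⊕-cong X-zero (Σ∞-cong X-suc)) ⟩
  shift m (one ⊕ Σ∞ (λ l → TΦ l ⊕ TΨ l))  ≈⟨ shift-cong m (⊕-congʳ one (Σ∞-⊕ TΦ TΨ)) ⟩
  shift m (one ⊕ (Φ ℓ ⊕ Ψ ℓ))             ∎
  where
  open ≗-Reasoning
  m = suc ℓ
  TΦ TΨ B X : ℕ → PS
  TΦ l = shift (m ℕ.* suc l) (Tails (suc l))
  TΨ l = shift (m ℕ.* suc l) (Above (suc l))
  B l = one ⊕ Σ< l (Above ∘ suc)
  X l = shift (m ℕ.* l) (B l)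
  X-zero : X 0 ≗ one
  X-zero n = trans (shift-*-zero m (one ⊕ 𝟘) n) (ℤₚ.+-identityʳ (one n))
  B-suc : ∀ l → B (suc l) ≗ Tails (suc l) ⊕ Above (suc l)
  B-suc l = ≗-trans (≗-sym (⊕-assoc one (Σ< l (Above ∘ suc)) (Above (suc l))))
                    (⊕-congˡ (Above (suc l)) (≗-sym (Tails-unfold l)))
  X-suc : ∀ l → X (suc l) ≗ TΦ l ⊕ TΨ l
  X-suc l = ≗-trans (shift-cong (m ℕ.* suc l) (B-suc l)) (shift-⊕ (m ℕ.* suc l) (Tails (suc l)) (Above (suc l)))

Ψ-equation : ∀ ℓ → Φ (suc ℓ) ⊕ Ψ ℓ ≗ shift (suc ℓ) (Φ 0 ⊕ Ψ ℓ)
Ψ-equation ℓ = begin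
  Φ (suc ℓ) ⊕ Ψ ℓ                 ≈⟨ Σ∞-⊕ TΦ′ TΨ ⟨
  Σ∞ (λ l → TΦ′ l ⊕ TΨ l)         ≈⟨ Σ∞-cong summand ⟩
  Σ∞ (λ l → shift m (Y l))        ≈⟨ shift-Σ∞ m (shift-*-summable ℓ Above) ⟨
  shift m (Σ∞ Y)                  ≈⟨ shift-cong m (Σ∞-suc (shift-*-summable ℓ Above)) ⟩
  shift m (Y 0 ⊕ Ψ ℓ)             ≈⟨ shift-cong m (⊕-congˡ (Ψ ℓ) Y-zero) ⟩
  shift m (Φ 0 ⊕ Ψ ℓ)             ∎
  where
  open ≗-Reasoning
  m = suc ℓ
  TΦ′ TΨ Y : ℕ → PS
  TΦ′ l = shift (suc m ℕ.* suc l) (Tails (suc l))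
  TΨ l = shift (m ℕ.* suc l) (Above (suc l))
  Y l = shift (m ℕ.* l) (Above l)
  Y-zero : Y 0 ≗ Φ 0
  Y-zero n = trans (shift-*-zero m (Above 0) n)
    (sumTo-cong n λ j _ → shift-≡ (Tails (suc j)) (sym (ℕₚ.+-identityʳ (suc j))) n)
  summand : ∀ l → TΦ′ l ⊕ TΨ l ≗ shift m (Y l)
  summand l = begin
    shift (suc l ℕ.+ k) (Tails (suc l)) ⊕ shift k (Above (suc l))
      ≈⟨ ⊕-congˡ (shift k (Above (suc l))) (shift-+ k (suc l) (Tails (suc l))) ⟩
    shift k (shift (suc l) (Tails (suc l))) ⊕ shift k (Above (suc l))
      ≈⟨ shift-⊕ k (shift (suc l) (Tails (suc l))) (Above (suc l)) ⟨
    shift k (shift (suc l) (Tails (suc l)) ⊕ Above (suc l))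
      ≈⟨ shift-cong k (Above-suc l) ⟨
    shift k (Above l)
      ≈⟨ shift-*-suc m l (Above l) ⟩
    shift m (Y l) ∎
    where k = m ℕ.* suc l

Ψ-solution : ∀ ℓ → Ψ ℓ ≗ geom ℓ ⊛ (shift (suc ℓ) (Φ 0) ⊕ neg (Φ (suc ℓ)))
Ψ-solution ℓ = geom-⊛-solves ℓ (Ψ ℓ) (shift (suc ℓ) (Φ 0) ⊕ neg (Φ (suc ℓ))) λ n →
  isolate (Φ (suc ℓ) n) (Ψ ℓ n) (shift (suc ℓ) (Φ 0) n) (shift (suc ℓ) (Ψ ℓ) n)
          (trans (Ψ-equation ℓ n) (shift-⊕ (suc ℓ) (Φ 0) (Ψ ℓ) n))
  where
  open +-*-Solver
  isolate : ∀ a b c d → a + b ≡ c + d → b ≡ (c + - a) + d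
  isolate a b c d eq = begin
    b                   ≡⟨ solve 2 (λ a b → b := a :+ b :+ :- a) refl a b ⟩
    a + b + - a         ≡⟨ cong (_+ - a) eq ⟩
    c + d + - a         ≡⟨ solve 3 (λ a c d → c :+ d :+ :- a := c :+ :- a :+ d) refl a c d ⟩
    c + - a + d         ∎
    where open ≡-Reasoning

Φ-solution : ∀ ℓ → Φ ℓ ≗ geom ℓ ⊛ shift (suc ℓ) (one ⊕ Ψ ℓ)
Φ-solution ℓ = geom-⊛-solves ℓ (Φ ℓ) (shift m (one ⊕ Ψ ℓ)) (begin
  Φ ℓ                                              ≈⟨ Φ-equation ℓ ⟩
  shift m (one ⊕ (Φ ℓ ⊕ Ψ ℓ))                      ≈⟨ shift-cong m (⊕-congʳ one (⊕-comm (Φ ℓ) (Ψ ℓ))) ⟩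
  shift m (one ⊕ (Ψ ℓ ⊕ Φ ℓ))                      ≈⟨ shift-cong m (⊕-assoc one (Ψ ℓ) (Φ ℓ)) ⟨
  shift m ((one ⊕ Ψ ℓ) ⊕ Φ ℓ)                      ≈⟨ shift-⊕ m (one ⊕ Ψ ℓ) (Φ ℓ) ⟩
  shift m (one ⊕ Ψ ℓ) ⊕ shift m (Φ ℓ)              ∎)
  where
  open ≗-Reasoning
  m = suc ℓ

geom-⊛-Ψ : ∀ K → geom K ⊛ Ψ K ≗ shift (suc K) (geom² K ⊛ Φ 0) ⊕ neg (geom² K ⊛ Φ (suc K))
geom-⊛-Ψ K = begin
  g ⊛ Ψ K                                  ≈⟨ ⊛-congʳ g (Ψ-solution K) ⟩
  g ⊛ (g ⊛ (shift m (Φ 0) ⊕ neg Φ′))       ≈⟨ ⊛-assoc g g (shift m (Φ 0) ⊕ neg Φ′) ⟨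
  (g ⊛ g) ⊛ (shift m (Φ 0) ⊕ neg Φ′)       ≈⟨ ⊛-distribˡ (g ⊛ g) (shift m (Φ 0)) (neg Φ′) ⟩
  (g ⊛ g) ⊛ shift m (Φ 0) ⊕ (g ⊛ g) ⊛ neg Φ′
                                           ≈⟨ ⊕-cong (⊛-shift m (g ⊛ g) (Φ 0)) (⊛-negʳ (g ⊛ g) Φ′) ⟩
  shift m ((g ⊛ g) ⊛ Φ 0) ⊕ neg ((g ⊛ g) ⊛ Φ′) ∎
  where
  open ≗-Reasoning
  m = suc K
  g = geom K
  Φ′ = Φ (suc K)

Φ-recurrence : ∀ K → Φ K ≗ shift (suc K) (geom K)
                           ⊕ (shift (suc K ℕ.+ suc K) (geom² K ⊛ Φ 0) ⊕ neg (shift (suc K) (geom² K ⊛ Φ (suc K))))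
Φ-recurrence K = begin
  Φ K                                                ≈⟨ Φ-solution K ⟩
  g ⊛ shift m (one ⊕ Ψ K)                            ≈⟨ ⊛-shift m g (one ⊕ Ψ K) ⟩
  shift m (g ⊛ (one ⊕ Ψ K))                          ≈⟨ shift-cong m (⊛-distribˡ g one (Ψ K)) ⟩
  shift m (g ⊛ one ⊕ g ⊛ Ψ K)                        ≈⟨ shift-cong m (⊕-cong (⊛-identityʳ g) (geom-⊛-Ψ K)) ⟩
  shift m (g ⊕ (shift m A ⊕ neg B))                  ≈⟨ shift-⊕ m g (shift m A ⊕ neg B) ⟩
  shift m g ⊕ shift m (shift m A ⊕ neg B)            ≈⟨ ⊕-congʳ (shift m g) (shift-⊕ m (shift m A) (neg B)) ⟩
  shift m g ⊕ (shift m (shift m A) ⊕ shift m (neg B))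
                                   ≈⟨ ⊕-congʳ (shift m g) (⊕-cong (shift-shift m m A) (shift-neg m B)) ⟩
  shift m g ⊕ (shift (m ℕ.+ m) A ⊕ neg (shift m B))  ∎
  where
  open ≗-Reasoning
  m = suc K
  g = geom K
  A = (g ⊛ g) ⊛ Φ 0
  B = (g ⊛ g) ⊛ Φ (suc K)

-- Telescoping

tri : ℕ → ℕ
tri zero    = 0
tri (suc K) = tri K ℕ.+ suc K

tri-*2 : ∀ K → tri K ℕ.* 2 ≡ K ℕ.* suc K
tri-*2 zero    = refl
tri-*2 (suc K) = begin
  (tri K ℕ.+ suc K) ℕ.* 2          ≡⟨ ℕₚ.*-distribʳ-+ 2 (tri K) (suc K) ⟩
  tri K ℕ.* 2 ℕ.+ suc K ℕ.* 2      ≡⟨ cong (ℕ._+ suc K ℕ.* 2) (tri-*2 K) ⟩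
  K ℕ.* suc K ℕ.+ suc K ℕ.* 2      ≡⟨ ℕ-Ring.solve [ K ] ⟩
  suc K ℕ.* suc (suc K)            ∎
  where open ≡-Reasoning

*2⇒≡/2 : ∀ m n → m ℕ.* 2 ≡ n → m ≡ n / 2
*2⇒≡/2 m .(m ℕ.* 2) refl = sym (m*n/n≡m m 2)

numExponent : ∀ K → tri (suc K) ≡ ((K ℕ.+ 2) ℕ.* (K ℕ.+ 1)) / 2
numExponent K =
  *2⇒≡/2 (tri (suc K)) ((K ℕ.+ 2) ℕ.* (K ℕ.+ 1)) (trans (tri-*2 (suc K)) (ℕ-Ring.solve [ K ]))

denExponent : ∀ K → tri K ℕ.+ (suc K ℕ.+ suc K) ≡ ((K ℕ.+ 4) ℕ.* (K ℕ.+ 1)) / 2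
denExponent K = *2⇒≡/2 (tri K ℕ.+ (suc K ℕ.+ suc K)) ((K ℕ.+ 4) ℕ.* (K ℕ.+ 1)) (begin
  (tri K ℕ.+ (suc K ℕ.+ suc K)) ℕ.* 2        ≡⟨ ℕₚ.*-distribʳ-+ 2 (tri K) (suc K ℕ.+ suc K) ⟩
  tri K ℕ.* 2 ℕ.+ (suc K ℕ.+ suc K) ℕ.* 2    ≡⟨ cong (ℕ._+ (suc K ℕ.+ suc K) ℕ.* 2) (tri-*2 K) ⟩
  K ℕ.* suc K ℕ.+ (suc K ℕ.+ suc K) ℕ.* 2    ≡⟨ ℕ-Ring.solve [ K ] ⟩
  (K ℕ.+ 4) ℕ.* (K ℕ.+ 1)                    ∎)
  where open ≡-Reasoning

weight : ℕ → PS
weight K = scale (sign K) (shift (tri K) (invPoch² K))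

weight-zero : weight 0 ≗ one
weight-zero n = trans (ℤₚ.*-identityˡ _) (⊛-identityˡ one n)

weight-order : ∀ K → Ord≥ (tri K) (weight K)
weight-order K = Ord≥-scale (sign K) (Ord≥-shift (tri K) (invPoch² K) ℕₚ.≤-refl)

scale-shift-⊛ : ∀ c a f g → scale c (shift a f) ⊛ g ≗ scale c (shift a (f ⊛ g))
scale-shift-⊛ c a f g n = trans (⊛-scaleˡ c (shift a f) g n) (cong (c *_) (shift-⊛ a f g n))

weight-⊛-shift : ∀ K a X → weight K ⊛ shift a X ≗ scale (sign K) (shift (tri K ℕ.+ a) (invPoch² K ⊛ X))
weight-⊛-shift K a X = begin
  weight K ⊛ shift a X                                  ≈⟨ scale-shift-⊛ (sign K) (tri K) P² (shift a X) ⟩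
  scale (sign K) (shift (tri K) (P² ⊛ shift a X))       ≈⟨ scale-cong (sign K) (shift-cong (tri K) (⊛-shift a P² X)) ⟩
  scale (sign K) (shift (tri K) (shift a (P² ⊛ X)))     ≈⟨ scale-cong (sign K) (shift-shift (tri K) a (P² ⊛ X)) ⟩
  scale (sign K) (shift (tri K ℕ.+ a) (P² ⊛ X))         ∎
  where
  open ≗-Reasoning
  P² = invPoch² K

invPoch²-⊛-geom² : ∀ K X → invPoch² K ⊛ (geom² K ⊛ X) ≗ invPoch² (suc K) ⊛ X
invPoch²-⊛-geom² K X = begin
  (P ⊛ P) ⊛ ((g ⊛ g) ⊛ X)   ≈⟨ ⊛-assoc (P ⊛ P) (g ⊛ g) X ⟨
  ((P ⊛ P) ⊛ (g ⊛ g)) ⊛ X   ≈⟨ ⊛-congˡ X (⊛-interchange P P g g) ⟩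
  ((P ⊛ g) ⊛ (P ⊛ g)) ⊛ X   ∎
  where
  open ≗-Reasoning
  P = invPoch K
  g = geom K

weight-⊛-geom : ∀ K → weight K ⊛ shift (suc K) (geom K) ≗ numTerm K
weight-⊛-geom K = ≗-trans (weight-⊛-shift K (suc K) (geom K))
  (scale-cong (sign K) (shift-≡ (invPoch² K ⊛ geom K) (numExponent K)))

weight-⊛-geom² : ∀ K X → weight K ⊛ shift (suc K ℕ.+ suc K) (geom² K ⊛ X) ≗ denTerm K ⊛ X
weight-⊛-geom² K X = begin
  weight K ⊛ shift (suc K ℕ.+ suc K) (geom² K ⊛ X)
    ≈⟨ weight-⊛-shift K (suc K ℕ.+ suc K) (geom² K ⊛ X) ⟩
  scale (sign K) (shift (tri K ℕ.+ (suc K ℕ.+ suc K)) (invPoch² K ⊛ (geom² K ⊛ X)))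
    ≈⟨ scale-cong (sign K) (shift-≡ (invPoch² K ⊛ (geom² K ⊛ X)) (denExponent K)) ⟩
  scale (sign K) (shift e (invPoch² K ⊛ (geom² K ⊛ X)))
    ≈⟨ scale-cong (sign K) (shift-cong e (invPoch²-⊛-geom² K X)) ⟩
  scale (sign K) (shift e (invPoch² (suc K) ⊛ X))
    ≈⟨ scale-shift-⊛ (sign K) e (invPoch² (suc K)) X ⟨
  denTerm K ⊛ X ∎
  where
  open ≗-Reasoning
  e = ((K ℕ.+ 4) ℕ.* (K ℕ.+ 1)) / 2

weight-⊛-neg-geom² : ∀ K X → weight K ⊛ neg (shift (suc K) (geom² K ⊛ X)) ≗ weight (suc K) ⊛ X
weight-⊛-neg-geom² K X = begin
  weight K ⊛ neg (shift (suc K) (geom² K ⊛ X))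
    ≈⟨ ⊛-negʳ (weight K) (shift (suc K) (geom² K ⊛ X)) ⟩
  neg (weight K ⊛ shift (suc K) (geom² K ⊛ X))
    ≈⟨ neg-cong (weight-⊛-shift K (suc K) (geom² K ⊛ X)) ⟩
  neg (scale (sign K) (shift (tri (suc K)) (invPoch² K ⊛ (geom² K ⊛ X))))
    ≈⟨ neg-scale (sign K) (shift (tri (suc K)) (invPoch² K ⊛ (geom² K ⊛ X))) ⟩
  scale (sign (suc K)) (shift (tri (suc K)) (invPoch² K ⊛ (geom² K ⊛ X)))
    ≈⟨ scale-cong (sign (suc K)) (shift-cong (tri (suc K)) (invPoch²-⊛-geom² K X)) ⟩
  scale (sign (suc K)) (shift (tri (suc K)) (invPoch² (suc K) ⊛ X))
    ≈⟨ scale-shift-⊛ (sign (suc K)) (tri (suc K)) (invPoch² (suc K)) X ⟨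
  weight (suc K) ⊛ X ∎
  where open ≗-Reasoning

Term : ℕ → PS
Term ℓ = numTerm ℓ ⊕ denTerm ℓ ⊛ Φ 0

weight-⊛-Φ : ∀ K → weight K ⊛ Φ K ≗ Term K ⊕ weight (suc K) ⊛ Φ (suc K)
weight-⊛-Φ K = begin
  w ⊛ Φ K                                                ≈⟨ ⊛-congʳ w (Φ-recurrence K) ⟩
  w ⊛ (shift m (geom K) ⊕ (A ⊕ B))                       ≈⟨ ⊛-distribˡ w (shift m (geom K)) (A ⊕ B) ⟩
  w ⊛ shift m (geom K) ⊕ w ⊛ (A ⊕ B)                     ≈⟨ ⊕-cong (weight-⊛-geom K) (⊛-distribˡ w A B) ⟩
  numTerm K ⊕ (w ⊛ A ⊕ w ⊛ B)                            ≈⟨ ⊕-congʳ (numTerm K) (⊕-cong (weight-⊛-geom² K (Φ 0))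
                                                                                 (weight-⊛-neg-geom² K (Φ (suc K)))) ⟩
  numTerm K ⊕ (denTerm K ⊛ Φ 0 ⊕ weight (suc K) ⊛ Φ (suc K))
                                                         ≈⟨ ⊕-assoc (numTerm K) (denTerm K ⊛ Φ 0) _ ⟨
  Term K ⊕ weight (suc K) ⊛ Φ (suc K)                    ∎
  where
  open ≗-Reasoning
  m = suc K
  w = weight K
  A = shift (m ℕ.+ m) (geom² K ⊛ Φ 0)
  B = neg (shift m (geom² K ⊛ Φ (suc K)))

Φ0-telescope : ∀ K → Φ 0 ≗ Σ< K Term ⊕ weight K ⊛ Φ K
Φ0-telescope zero    = begin
  Φ 0                       ≈⟨ ⊛-identityˡ (Φ 0) ⟨
  one ⊛ Φ 0                 ≈⟨ ⊛-congˡ (Φ 0) weight-zero ⟨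
  weight 0 ⊛ Φ 0            ≈⟨ (λ n → ℤₚ.+-identityˡ _) ⟨
  𝟘 ⊕ weight 0 ⊛ Φ 0        ∎
  where open ≗-Reasoning
Φ0-telescope (suc K) = begin
  Φ 0                                                ≈⟨ Φ0-telescope K ⟩
  Σ< K Term ⊕ weight K ⊛ Φ K                         ≈⟨ ⊕-congʳ (Σ< K Term) (weight-⊛-Φ K) ⟩
  Σ< K Term ⊕ (Term K ⊕ weight (suc K) ⊛ Φ (suc K))  ≈⟨ ⊕-assoc (Σ< K Term) (Term K) _ ⟨
  Σ< (suc K) Term ⊕ weight (suc K) ⊛ Φ (suc K)       ∎
  where open ≗-Reasoning

denTerm-summable : Summable denTerm
denTerm-summable ℓ = Ord≥-scale (sign ℓ) (Ord≥-shift _ (invPoch² (suc ℓ)) (subst (ℓ ≤_) (denExponent ℓ)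
  (ℕₚ.≤-trans (ℕₚ.n≤1+n ℓ) (ℕₚ.≤-trans (ℕₚ.m≤m+n (suc ℓ) (suc ℓ)) (ℕₚ.m≤n+m _ (tri ℓ))))))

Φ0-coefficient : ∀ N → Φ 0 N ≡ Numerator N + (DenSum ⊛ Φ 0) N
Φ0-coefficient N = begin
  Φ 0 N                                                  ≡⟨ Φ0-telescope (suc N) N ⟩
  Σ< (suc N) Term N + (weight (suc N) ⊛ Φ (suc N)) N     ≡⟨ cong (λ x → Σ< (suc N) Term N + x) remainder ⟩
  Σ< (suc N) Term N + + 0                                ≡⟨ ℤₚ.+-identityʳ _ ⟩
  Σ< (suc N) Term N                                      ≡⟨ Σ<-sumTo N Term N ⟩
  sumTo N (λ ℓ → numTerm ℓ N + (denTerm ℓ ⊛ Φ 0) N)      ≡⟨ sumTo-+ N (λ ℓ → numTerm ℓ N) _ ⟩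
  Numerator N + sumTo N (λ ℓ → (denTerm ℓ ⊛ Φ 0) N)      ≡⟨ cong (λ x → Numerator N + x) denominatorPart ⟩
  Numerator N + (DenSum ⊛ Φ 0) N                         ∎
  where
  open ≡-Reasoning
  remainder : (weight (suc N) ⊛ Φ (suc N)) N ≡ + 0
  remainder = Ord≥-⊛ (Φ (suc N)) (weight-order (suc N)) N (ℕₚ.m≤n+m (suc N) (tri N))
  denominatorPart : sumTo N (λ ℓ → (denTerm ℓ ⊛ Φ 0) N) ≡ (DenSum ⊛ Φ 0) N
  denominatorPart = begin
    sumTo N (λ ℓ → (denTerm ℓ ⊛ Φ 0) N)    ≡⟨ Σ<-sumTo N (λ ℓ → denTerm ℓ ⊛ Φ 0) N ⟨
    Σ< (suc N) (λ ℓ → denTerm ℓ ⊛ Φ 0) N   ≡⟨ Σ<-⊛ (suc N) denTerm (Φ 0) N ⟨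
    (Σ< (suc N) denTerm ⊛ Φ 0) N           ≡⟨ ⊛-congˡ-upTo (Φ 0) N (λ _ → Σ<-Σ∞ denTerm-summable N) ⟩
    (DenSum ⊛ Φ 0) N                       ∎

Φ0-⊛-Denominator : ∀ N → (Φ 0 ⊛ Denominator) N ≡ Numerator N
Φ0-⊛-Denominator N = begin
  (Φ 0 ⊛ (one ⊕ neg DenSum)) N           ≡⟨ ⊛-distribˡ (Φ 0) one (neg DenSum) N ⟩
  (Φ 0 ⊛ one) N + (Φ 0 ⊛ neg DenSum) N   ≡⟨ cong₂ _+_ (⊛-identityʳ (Φ 0) N) (⊛-negʳ (Φ 0) DenSum N) ⟩
  Φ 0 N + - (Φ 0 ⊛ DenSum) N             ≡⟨ cong₂ (λ x y → x + - y) (Φ0-coefficient N) (⊛-comm (Φ 0) DenSum N) ⟩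
  Numerator N + D + - D                  ≡⟨ solve 2 (λ a b → a :+ b :+ :- b := a) refl (Numerator N) D ⟩
  Numerator N                            ∎
  where
  open ≡-Reasoning
  open +-*-Solver
  D = (DenSum ⊛ Φ 0) N

theorem2p9 : Σ (ℕ → ℕ) (λ G → ((n : ℕ) → Fin (G n) ↔ StanleyOfArea n) × ((n : ℕ) → (ofCount G ⊛ Denominator) n ≡ Numerator n))
theorem2p9 = polyominoes , Fin-polyominoes , λ n →
  trans (⊛-congˡ Denominator polyominoes-gf n) (Φ0-⊛-Denominator n)
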